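{- Fix an integer $r \geq 2$ and let $T$ be the collection of all non-complete connected $r$-regular (finite) graphs. Then $T$ is $r$-permissible.
   Context: For a graph $G$ and $r \geq 0$, let $G^r$ denote the subgraph of $G$ induced on the vertices having degree exactly $r$ in $G$. For $r \geq 2$, a collection $T$ of graphs is called $r$-permissible if all of the following hold: (1) every $G \in T$ is connected; (2) $\Delta(G) = r$ for each $G \in T$; (3) $\delta(G^r) > 0$ for each $G \in T$ (minimum degree of $G^r$ is positive); (4) if $G \in T$ and $x \in V(G^r)$, then $G - x \notin T$; (5) if $G \in T$ and $x \in V(G^r)$, then there exists $y \in V(G^r) \setminus N_G(x)$ such that $G - y$ is connected; (6) if $G \in T$, $x \in V(G^r)$, $H = G - x$, $A \subseteq V(H)$ with $|A| = r$, and $H_A$ is the graph obtained from $H$ by adding a new vertex $y$ joined exactly to the vertices of $A$, then $H_A \in T$ implies $A \cap N_G(x) \cap V(G^r) \neq \emptyset$. For $r = 0, 1$ the empty collection is the only $r$-permissible collection. -}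

module Defs where

open import Data.Bool using (Bool; true; false; if_then_else_)
open import Data.Nat using (ℕ; zero; suc; _+_; _≤_; _<_)
open import Data.Fin using (Fin; zero; suc; punchIn)
open import Data.Fin.Subset using (Subset; ∣_∣)
open import Data.List using (map; allFin)
open import Data.Nat.ListAction using (sum)
open import Data.Vec using (lookup)
open import Data.Product using (Σ; ∃; _×_; _,_)
open import Relation.Binary.PropositionalEquality using (_≡_; _≢_; refl)
open import Relation.Nullary using (¬_)

record Graph (n : ℕ) : Set where
  field
    adj    : Fin n → Fin n → Bool
    sym    : ∀ i j → adj i j ≡ adj j i
    irrefl : ∀ i → adj i i ≡ false
open Graph public

deg : ∀ {n} → Graph n → Fin n → ℕ
deg {n} G v = sum (map (λ u → if adj G v u then 1 else 0) (allFin n))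

data Reach {n} (G : Graph n) : Fin n → Fin n → Set where
  here : ∀ {u} → Reach G u u
  step : ∀ {u w v} → adj G u w ≡ true → Reach G w v → Reach G u v

Connected : ∀ {n} → Graph n → Set
Connected {n} G = ∀ (u v : Fin n) → Reach G u v

Complete : ∀ {n} → Graph n → Set
Complete {n} G = ∀ (i j : Fin n) → i ≢ j → adj G i j ≡ true

Regular : ℕ → ∀ {n} → Graph n → Set
Regular r {n} G = ∀ (v : Fin n) → deg G v ≡ r

MaxDegreeIs : ∀ {n} → Graph n → ℕ → Set
MaxDegreeIs {n} G r = (Σ (Fin n) λ v → deg G v ≡ r) × (∀ (v : Fin n) → deg G v ≤ r)

-- δ(G^r) > 0 : G^r is the subgraph induced on the vertices of degree exactly r;
-- every vertex of G^r has a neighbour inside G^r.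
MinDegTopPositive : ∀ {n} → Graph n → ℕ → Set
MinDegTopPositive {n} G r =
  ∀ (v : Fin n) → deg G v ≡ r → Σ (Fin n) λ u → adj G v u ≡ true × deg G u ≡ r

-- vertex deletion G - x  (vertices of G - x are Fin m, embedded via punchIn x)
delete : ∀ {m} → Graph (suc m) → Fin (suc m) → Graph m
delete G x = record
  { adj    = λ i j → adj G (punchIn x i) (punchIn x j)
  ; sym    = λ i j → sym G (punchIn x i) (punchIn x j)
  ; irrefl = λ i → irrefl G (punchIn x i)
  }

-- H_A : add a new vertex (index zero) joined exactly to the vertices in A
addVertex : ∀ {m} → Graph m → Subset m → Graph (suc m)
addVertex {m} H A = record { adj = a ; sym = s ; irrefl = ir }
  where
  a : Fin (suc m) → Fin (suc m) → Bool
  a zero zero = false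
  a zero (suc j) = lookup A j
  a (suc i) zero = lookup A i
  a (suc i) (suc j) = adj H i j
  s : ∀ i j → a i j ≡ a j i
  s zero zero = refl
  s zero (suc j) = refl
  s (suc i) zero = refl
  s (suc i) (suc j) = sym H i j
  ir : ∀ i → a i i ≡ false
  ir zero = refl
  ir (suc i) = irrefl H i

Collection : Set₁
Collection = ∀ {n} → Graph n → Set

EmptyCollection : Collection → Set
EmptyCollection T = ∀ {n} (G : Graph n) → ¬ T G

-- conditions (1)-(6) of r-permissibility
PermissibleConds : ℕ → Collection → Set
PermissibleConds r T =
    (∀ {n} (G : Graph n) → T G → Connected G)
  × (∀ {n} (G : Graph n) → T G → MaxDegreeIs G r)
  × (∀ {n} (G : Graph n) → T G → MinDegTopPositive G r)
  × (∀ {m} (G : Graph (suc m)) (x : Fin (suc m)) → T G → deg G x ≡ r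
       → ¬ T (delete G x))
  × (∀ {m} (G : Graph (suc m)) (x : Fin (suc m)) → T G → deg G x ≡ r
       → Σ (Fin (suc m)) λ y → deg G y ≡ r × adj G x y ≡ false
           × Connected (delete G y))
  × (∀ {m} (G : Graph (suc m)) (x : Fin (suc m)) → T G → deg G x ≡ r
       → (A : Subset m) → ∣ A ∣ ≡ r → T (addVertex (delete G x) A)
       → Σ (Fin m) λ i → lookup A i ≡ true × adj G x (punchIn x i) ≡ true
           × deg G (punchIn x i) ≡ r)

Permissible : ℕ → Collection → Set
Permissible zero T = EmptyCollection T
Permissible (suc zero) T = EmptyCollection T
Permissible (suc (suc k)) T = PermissibleConds (suc (suc k)) T

NonCompleteConnRegular : ℕ → Collection
NonCompleteConnRegular r G = Connected G × Regular r G × ¬ Complete G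

-- Conditions (2)-(4) and (6) are degree counting: deleting a vertex lowers the degree of
-- each of its neighbours by one, and in H_A a vertex of A gains exactly one neighbour.
-- For (5) take y at maximal distance from x.  Every other vertex has a shortest walk to x,
-- and such a walk never meets y, so G - y stays connected.  The distance of y is at least 2:
-- otherwise x is adjacent to all other vertices, so by regularity every vertex is, and G is
-- complete.
module Submission where

open import Defs
open import Data.Bool using (Bool; true; false; if_then_else_)
open import Data.Bool.Properties using () renaming (_≟_ to _≟ᵇ_)
open import Data.Nat using (ℕ; zero; suc; _+_; _≤_; z≤n; s≤s)
open import Data.Nat.Properties
  using (+-0-commutativeMonoid; 1+n≢n; 1+n≰n; ≤-refl; ≤-reflexive; m≤m+n; m≤n+m; m≤n⇒m≤1+n; n≤1+n; suc-injective)
open import Data.Fin using (Fin; zero; suc; punchIn; punchOut; _≟_)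
open import Data.Fin.Properties using (punchIn-punchOut; punchInᵢ≢i; punchIn-injective; all?; any?; ¬∀⟶∃¬)
open import Data.Fin.Subset using (Subset; ∣_∣)
open import Data.Fin.Subset.Properties using (nonempty?; Empty-unique; ∣⊥∣≡0)
open import Data.Vec using (lookup)
open import Data.Vec.Properties using ([]=⇒lookup)
open import Data.Vec.Functional using (removeAt)
open import Data.List using (tabulate)
open import Data.List.Properties using (map-tabulate)
import Data.Nat.ListAction as List
open import Data.Product using (∃; _×_; _,_; proj₁)
open import Function using (id; _∘_)
open import Relation.Nullary using (¬_; Dec; yes; no; contradiction)
open import Relation.Nullary.Decidable using (_×-dec_)
open import Relation.Binary.PropositionalEquality
  using (_≡_; _≢_; refl; trans; cong; cong₂; subst; module ≡-Reasoning)
  renaming (sym to ≡-sym)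
open import Algebra.Properties.CommutativeMonoid.Sum +-0-commutativeMonoid using (sum; sum-remove)

indicator : Bool → ℕ
indicator b = if b then 1 else 0

count : ∀ {n} → (Fin n → Bool) → ℕ
count f = sum (indicator ∘ f)

count-removeAt : ∀ {n} (f : Fin (suc n) → Bool) i → count f ≡ indicator (f i) + count (removeAt f i)
count-removeAt f i = sum-remove {i = i} (indicator ∘ f)

count≤n : ∀ {n} (f : Fin n → Bool) → count f ≤ n
count≤n {zero} f = z≤n
count≤n {suc n} f with f zero
... | true = s≤s (count≤n (f ∘ suc))
... | false = m≤n⇒m≤1+n (count≤n (f ∘ suc))

count≡n⇒all : ∀ {n} (f : Fin n → Bool) → count f ≡ n → ∀ i → f i ≡ true
count≡n⇒all {suc n} f eq i with f zero in f0
count≡n⇒all {suc n} f eq zero | true = f0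
count≡n⇒all {suc n} f eq (suc i) | true = count≡n⇒all (f ∘ suc) (suc-injective eq) i
... | false = contradiction (subst (_≤ n) eq (count≤n (f ∘ suc))) 1+n≰n

all⇒count≡n : ∀ {n} (f : Fin n → Bool) → (∀ i → f i ≡ true) → count f ≡ n
all⇒count≡n {zero} f all = refl
all⇒count≡n {suc n} f all rewrite all zero = cong suc (all⇒count≡n (f ∘ suc) (all ∘ suc))

count≡suc⇒∃ : ∀ {n k} (f : Fin n → Bool) → count f ≡ suc k → ∃ λ i → f i ≡ true
count≡suc⇒∃ {suc n} f eq with f zero in f0
... | true = zero , f0
... | false = let i , fi = count≡suc⇒∃ (f ∘ suc) eq in suc i , fi

List-sum-tabulate : ∀ {n} (g : Fin n → ℕ) → List.sum (tabulate g) ≡ sum g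
List-sum-tabulate {zero} g = refl
List-sum-tabulate {suc n} g = cong (g zero +_) (List-sum-tabulate (g ∘ suc))

deg≡count : ∀ {n} (G : Graph n) v → deg G v ≡ count (adj G v)
deg≡count {n} G v =
  trans (cong List.sum (map-tabulate {n = n} id (indicator ∘ adj G v))) (List-sum-tabulate (indicator ∘ adj G v))

deg≡suc⇒neighbour : ∀ {n k} (G : Graph n) v → deg G v ≡ suc k → ∃ λ u → adj G v u ≡ true
deg≡suc⇒neighbour G v d = count≡suc⇒∃ (adj G v) (trans (≡-sym (deg≡count G v)) d)

deg-punchIn : ∀ {m} (G : Graph (suc m)) x i →
  deg G (punchIn x i) ≡ indicator (adj G (punchIn x i) x) + deg (delete G x) i
deg-punchIn G x i = begin
  deg G (punchIn x i)                                                ≡⟨ deg≡count G (punchIn x i) ⟩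
  count (adj G (punchIn x i))                                        ≡⟨ count-removeAt (adj G (punchIn x i)) x ⟩
  indicator (adj G (punchIn x i) x) + count (adj (delete G x) i)     ≡⟨ cong (indicator (adj G (punchIn x i) x) +_) (deg≡count (delete G x) i) ⟨
  indicator (adj G (punchIn x i) x) + deg (delete G x) i             ∎
  where open ≡-Reasoning

deg-addVertex : ∀ {m} (H : Graph m) A i → deg (addVertex H A) (suc i) ≡ indicator (lookup A i) + deg H i
deg-addVertex H A i = trans (deg≡count (addVertex H A) (suc i)) (cong (indicator (lookup A i) +_) (≡-sym (deg≡count H i)))

deg≡count-others : ∀ {m} (G : Graph (suc m)) v → deg G v ≡ count (removeAt (adj G v) v)
deg≡count-others G v =
  trans (deg≡count G v) (trans (count-removeAt (adj G v) v) (cong (λ b → indicator b + others) (irrefl G v)))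
  where others = count (removeAt (adj G v) v)

adj⇒≢ : ∀ {n} (G : Graph n) {u v} → adj G u v ≡ true → u ≢ v
adj⇒≢ G {u} u~v refl = contradiction (trans (≡-sym u~v) (irrefl G u)) λ ()

Dominating : ∀ {n} → Graph n → Fin n → Set
Dominating G v = ∀ u → v ≢ u → adj G v u ≡ true

deg≡m⇒dominating : ∀ {m} (G : Graph (suc m)) v → deg G v ≡ m → Dominating G v
deg≡m⇒dominating G v d u v≢u = subst (λ w → adj G v w ≡ true) (punchIn-punchOut v≢u)
  (count≡n⇒all _ (trans (≡-sym (deg≡count-others G v)) d) (punchOut v≢u))

dominating⇒deg≡m : ∀ {m} (G : Graph (suc m)) v → Dominating G v → deg G v ≡ m
dominating⇒deg≡m G v dom =
  trans (deg≡count-others G v) (all⇒count≡n _ λ i → dom (punchIn v i) (punchInᵢ≢i v i ∘ ≡-sym))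

regular-dominating⇒complete : ∀ {m r} (G : Graph (suc m)) → Regular r G → ∀ x → Dominating G x → Complete G
regular-dominating⇒complete G reg x dom v =
  deg≡m⇒dominating G v (trans (reg v) (trans (≡-sym (reg x)) (dominating⇒deg≡m G x dom)))

reach-trans : ∀ {n} {G : Graph n} {u v w} → Reach G u v → Reach G v w → Reach G u w
reach-trans here q = q
reach-trans (step e p) q = step e (reach-trans p q)

reach-sym : ∀ {n} {G : Graph n} {u v} → Reach G u v → Reach G v u
reach-sym here = here
reach-sym {G = G} (step {u} {w} e p) = reach-trans (reach-sym p) (step (trans (sym G w u) e) here)

data Within {n} (G : Graph n) (x : Fin n) : ℕ → Fin n → Set where
  at-target : ∀ {k} → Within G x k x
  via       : ∀ {k v u} → adj G v u ≡ true → Within G x k u → Within G x (suc k) v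

module _ {n} {G : Graph n} {x : Fin n} where

  Within-mono : ∀ {j k v} → j ≤ k → Within G x j v → Within G x k v
  Within-mono _ at-target = at-target
  Within-mono (s≤s j≤k) (via e w) = via e (Within-mono j≤k w)

  within? : ∀ k v → Dec (Within G x k v)
  within? zero v with v ≟ x
  ... | yes refl = yes at-target
  ... | no v≢x = no λ { at-target → v≢x refl }
  within? (suc k) v with v ≟ x | any? (λ u → (adj G v u ≟ᵇ true) ×-dec within? k u)
  ... | yes refl | _ = yes at-target
  ... | no _ | yes (u , e , w) = yes (via e w)
  ... | no v≢x | no no-step = no λ { at-target → v≢x refl ; (via e w) → no-step (_ , e , w) }

  reach⇒within : ∀ {v} → Reach G v x → ∃ λ k → Within G x k v
  reach⇒within here = 0 , at-target
  reach⇒within (step e r) = let k , w = reach⇒within r in suc k , via e w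

  within-one⇒dominating : (∀ v → Within G x 1 v) → Dominating G x
  within-one⇒dominating near u x≢u with near u
  ... | at-target = contradiction refl x≢u
  ... | via e at-target = trans (sym G x u) e

  ¬within⇒nonadjacent : ∀ {k y} → ¬ Within G x (suc k) y → adj G x y ≡ false
  ¬within⇒nonadjacent {y = y} far with adj G x y in e
  ... | false = refl
  ... | true = contradiction (Within-mono (s≤s z≤n) (via (trans (sym G y x) e) at-target)) far

uniform-bound : ∀ {n p} (P : Fin n → ℕ → Set p) → (∀ {i j k} → j ≤ k → P i j → P i k) →
  (∀ i → ∃ (P i)) → ∃ λ K → ∀ i → P i K
uniform-bound {zero} P mono bounded = 0 , λ ()
uniform-bound {suc n} P mono bounded =
  let k₀ , p₀ = bounded zero
      K , ps = uniform-bound (P ∘ suc) mono (bounded ∘ suc)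
  in k₀ + K , λ { zero → mono (m≤m+n k₀ K) p₀ ; (suc i) → mono (m≤n+m K k₀) (ps i) }

threshold : ∀ {p} {P : ℕ → Set p} → (∀ k → Dec (P k)) → ¬ P 1 → ∀ {L} → P (suc L) →
  ∃ λ k → ¬ P (suc k) × P (suc (suc k))
threshold P? ¬P1 {zero} P1 = contradiction P1 ¬P1
threshold P? ¬P1 {suc L} PL with P? (suc L)
... | yes PL′ = threshold P? ¬P1 PL′
... | no ¬PL′ = L , ¬PL′ , PL

delete-farthest-connected : ∀ {m k} (G : Graph (suc m)) x y →
  ¬ Within G x k y → (∀ v → Within G x (suc k) v) → Connected (delete G y)
delete-farthest-connected {k = k} G x y far near i j = reach-trans (to-x i) (reach-sym (to-x j))
  where
  y≢x : y ≢ x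
  y≢x y≡x = far (subst (Within G x k) (≡-sym y≡x) at-target)

  walk : ∀ {l v} → Within G x l v → l ≤ suc k → ∀ i → punchIn y i ≡ v → Reach (delete G y) i (punchOut y≢x)
  walk at-target _ i i≡x =
    subst (Reach (delete G y) i) (punchIn-injective y i _ (trans i≡x (≡-sym (punchIn-punchOut y≢x)))) here
  walk (via {u = u} e w) (s≤s l≤k) i refl =
    step (subst (λ t → adj G (punchIn y i) t ≡ true) (≡-sym (punchIn-punchOut y≢u)) e)
         (walk w (m≤n⇒m≤1+n l≤k) (punchOut y≢u) (punchIn-punchOut y≢u))
    where
    y≢u : y ≢ u
    y≢u y≡u = far (Within-mono l≤k (subst (Within G x _) (≡-sym y≡u) w))

  to-x : ∀ i → Reach (delete G y) i (punchOut y≢x)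
  to-x i = walk (near (punchIn y i)) ≤-refl i refl

∃-nonadjacent-non-cut-vertex : ∀ {m r} (G : Graph (suc m)) → Connected G → Regular r G → ¬ Complete G →
  ∀ x → ∃ λ y → adj G x y ≡ false × Connected (delete G y)
∃-nonadjacent-non-cut-vertex G conn reg incomplete x =
  let L , within-L = uniform-bound (λ v k → Within G x k v) Within-mono (λ v → reach⇒within (conn v x))
      k , not-all , all = threshold {P = λ k → ∀ v → Within G x k v} (λ k → all? (within? k)) not-all-within-one
                            (λ v → Within-mono (n≤1+n L) (within-L v))
      y , far = ¬∀⟶∃¬ _ (Within G x (suc k)) (within? (suc k)) not-all
  in y , ¬within⇒nonadjacent far , delete-farthest-connected G x y far all
  where
  not-all-within-one : ¬ (∀ v → Within G x 1 v)
  not-all-within-one = incomplete ∘ regular-dominating⇒complete G reg x ∘ within-one⇒dominating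

regular-incomplete⇒MaxDegreeIs : ∀ {n r} (G : Graph n) → Regular r G → ¬ Complete G → MaxDegreeIs G r
regular-incomplete⇒MaxDegreeIs {zero} G reg incomplete = contradiction (λ ()) incomplete
regular-incomplete⇒MaxDegreeIs {suc n} G reg incomplete = (zero , reg zero) , ≤-reflexive ∘ reg

regular⇒MinDegTopPositive : ∀ {n k} (G : Graph n) → Regular (suc k) G → MinDegTopPositive G (suc k)
regular⇒MinDegTopPositive G reg v d = let u , e = deg≡suc⇒neighbour G v d in u , e , reg u

delete-not-regular : ∀ {m k} (G : Graph (suc m)) x → Regular (suc k) G → ¬ Regular (suc k) (delete G x)
delete-not-regular {k = k} G x reg reg-del with deg≡suc⇒neighbour G x (reg x)
... | u , x~u = 1+n≢n (≡-sym (begin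
  suc k                                                        ≡⟨ reg (punchIn x i) ⟨
  deg G (punchIn x i)                                          ≡⟨ deg-punchIn G x i ⟩
  indicator (adj G (punchIn x i) x) + deg (delete G x) i       ≡⟨ cong₂ (λ b d → indicator b + d) i~x (reg-del i) ⟩
  suc (suc k)                                                  ∎))
  where
  open ≡-Reasoning
  x≢u = adj⇒≢ G x~u
  i = punchOut x≢u
  i~x : adj G (punchIn x i) x ≡ true
  i~x = subst (λ t → adj G t x ≡ true) (≡-sym (punchIn-punchOut x≢u)) (trans (sym G u x) x~u)

addVertex-regular⇒adjacent : ∀ {m r} (G : Graph (suc m)) x A i → Regular r G →
  Regular r (addVertex (delete G x) A) → lookup A i ≡ true → adj G x (punchIn x i) ≡ true
addVertex-regular⇒adjacent {r = r} G x A i reg reg-A i∈A with adj G (punchIn x i) x in i~x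
... | true = trans (sym G x (punchIn x i)) i~x
... | false = contradiction (≡-sym (begin
  deg (delete G x) i                                           ≡⟨ cong (λ b → indicator b + d) i~x ⟨
  indicator (adj G (punchIn x i) x) + d                        ≡⟨ deg-punchIn G x i ⟨
  deg G (punchIn x i)                                          ≡⟨ reg (punchIn x i) ⟩
  r                                                            ≡⟨ reg-A (suc i) ⟨
  deg (addVertex (delete G x) A) (suc i)                       ≡⟨ deg-addVertex (delete G x) A i ⟩
  indicator (lookup A i) + d                                   ≡⟨ cong (λ b → indicator b + d) i∈A ⟩
  suc d                                                        ∎)) 1+n≢n
  where
  open ≡-Reasoning
  d = deg (delete G x) i

∣p∣≡suc⇒∃-inside : ∀ {m k} (p : Subset m) → ∣ p ∣ ≡ suc k → ∃ λ i → lookup p i ≡ true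
∣p∣≡suc⇒∃-inside {m} p ∣p∣≡1+k with nonempty? p
... | yes (i , i∈p) = i , []=⇒lookup i∈p
... | no empty = contradiction (trans (≡-sym ∣p∣≡1+k) (trans (cong ∣_∣ (Empty-unique empty)) (∣⊥∣≡0 m))) λ ()

lemma1 : (r : ℕ) → 2 ≤ r → Permissible r (NonCompleteConnRegular r)
lemma1 zero ()
lemma1 (suc zero) (s≤s ())
lemma1 (suc (suc k)) _ =
    (λ G → proj₁)
  , (λ { G (_ , reg , incomplete) → regular-incomplete⇒MaxDegreeIs G reg incomplete })
  , (λ { G (_ , reg , _) → regular⇒MinDegTopPositive G reg })
  , (λ { G x (_ , reg , _) _ (_ , reg-del , _) → delete-not-regular G x reg reg-del })
  , (λ { G x (conn , reg , incomplete) _ →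
         let y , x≁y , conn-del = ∃-nonadjacent-non-cut-vertex G conn reg incomplete x
         in y , reg y , x≁y , conn-del })
  , (λ { G x (_ , reg , _) _ A ∣A∣≡r (_ , reg-A , _) →
         let i , i∈A = ∣p∣≡suc⇒∃-inside A ∣A∣≡r
         in i , i∈A , addVertex-regular⇒adjacent G x A i reg reg-A i∈A , reg (punchIn x i) })
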